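{- Let $\mathcal{C}$ be a standard closure system over a finite set $U$ with acyclic split $(U_1,U_2)$, and let $\mathcal{C}_2=\{C\in\mathcal{C}: C\subseteq U_2\}$, with set of meet-irreducible elements $\mathcal{M}_2$. Let $C_2\in\mathcal{C}_2$ with $C_2\neq U_2$ and $C_2\notin\mathcal{M}_2$. Then no $C\in\mathcal{C}$ with $C\cap U_2=C_2$ is a meet-irreducible element of $\mathcal{C}$.
   Context: A closure system over $U$ is a family $\mathcal{C}$ of subsets of $U$ with $U\in\mathcal{C}$ and closed under intersection; with closure operator $\phi(X)=\bigcap\{C\in\mathcal{C}: X\subseteq C\}$ it is standard if $\phi(\{u\})\setminus\{u\}\in\mathcal{C}$ for every $u\in U$. $\mathcal{C}_2$ is a closure system over $U_2$. A meet-irreducible element of a closure system $\mathcal{F}$ over a set $V$ is a closed set $M\neq V$ such that $M=C\cap C'$ with $C,C'\in\mathcal{F}$ implies $M=C$ or $M=C'$ (equivalently, $M$ has exactly one upper cover in $\mathcal{F}$). An implication over $U$ is written $A \to b$ with $A \subseteq U$ nonempty and $b \in U$; an implicational base is a finite set of implications; $\Sigma$ is an implicational base for $\mathcal{C}$ if $\mathcal{C}$ is exactly the family of $C\subseteq U$ such that $A\subseteq C$ implies $b\in C$ for all $A\to b\in\Sigma$. For $X\subseteq U$, $\Sigma[X]=\{A\to b\in\Sigma: A\cup\{b\}\subseteq X\}$, and $\Sigma[U_1,U_2]:=\Sigma\setminus(\Sigma[U_1]\cup\Sigma[U_2])$. A bipartition $(U_1,U_2)$ of $U$ into nonempty disjoint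 parts with $U_2\in\mathcal{C}$ is an acyclic split of $\mathcal{C}$ if there is an implicational base $\Sigma$ for $\mathcal{C}$ in which every premise is contained in $U_1$ or in $U_2$ and every $A\to b\in\Sigma[U_1,U_2]$ has $A\subseteq U_1$. -}

module Defs where

open import Data.Nat using (ℕ)
open import Data.Fin using (Fin)
open import Data.Fin.Subset using (Subset; ⊤; ⁅_⁆; _∈_; _⊆_; ∁; _∩_; _∪_; _─_; Nonempty)
open import Data.Product using (Σ; _×_; _,_; proj₁; proj₂)
open import Data.Sum using (_⊎_)
open import Data.List using (List)
open import Data.List.Membership.Propositional using () renaming (_∈_ to _∈ₗ_)
open import Relation.Binary.PropositionalEquality using (_≡_; _≢_)
open import Relation.Nullary using (¬_)
open import Relation.Unary using (Pred)
open import Level using (0ℓ)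

-- The ground set U is Fin n; subsets of U are Data.Fin.Subset.
-- A family of subsets of U is a predicate on subsets.
Family : ℕ → Set₁
Family n = Pred (Subset n) 0ℓ

module _ {n : ℕ} where

  IsClosureSystem : Family n → Set
  IsClosureSystem 𝒞 = 𝒞 ⊤ × (∀ C C′ → 𝒞 C → 𝒞 C′ → 𝒞 (C ∩ C′))

  -- Y = φ(X) = ⋂ {C ∈ 𝒞 : X ⊆ C}, i.e. Y is the least member of 𝒞 containing X
  IsClosureOf : Family n → Subset n → Subset n → Set
  IsClosureOf 𝒞 X Y = 𝒞 Y × X ⊆ Y × (∀ Z → 𝒞 Z → X ⊆ Z → Y ⊆ Z)

  IsStandard : Family n → Set
  IsStandard 𝒞 = ∀ (u : Fin n) (Y : Subset n) → IsClosureOf 𝒞 ⁅ u ⁆ Y → 𝒞 (Y ─ ⁅ u ⁆)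

  IsMeetIrreducible : Family n → Subset n → Subset n → Set
  IsMeetIrreducible 𝒻 V M =
    𝒻 M × M ≢ V × (∀ C C′ → 𝒻 C → 𝒻 C′ → M ≡ C ∩ C′ → M ≡ C ⊎ M ≡ C′)

  record Implication : Set where
    constructor _⇒_
    field
      premise    : Subset n
      conclusion : Fin n
  open Implication public

  ValidImplication : Implication → Set
  ValidImplication i = Nonempty (premise i)

  Respects : Subset n → Implication → Set
  Respects C i = premise i ⊆ C → conclusion i ∈ C

  IsImplicationalBase : List Implication → Family n → Set
  IsImplicationalBase Σ′ 𝒞 =
    (∀ {i} → i ∈ₗ Σ′ → ValidImplication i) ×
    (∀ C → (𝒞 C → ∀ {i} → i ∈ₗ Σ′ → Respects C i)
         × ((∀ {i} → i ∈ₗ Σ′ → Respects C i) → 𝒞 C))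

  InsideOf : Subset n → Implication → Set
  InsideOf X i = (premise i ∪ ⁅ conclusion i ⁆) ⊆ X

  -- (U₁, U₂) with U₁ = ∁ U₂ is an acyclic split of 𝒞
  IsAcyclicSplit : Family n → Subset n → Set
  IsAcyclicSplit 𝒞 U₂ =
    Nonempty (∁ U₂) × Nonempty U₂ × 𝒞 U₂ ×
    Σ (List Implication) λ Σ′ →
      IsImplicationalBase Σ′ 𝒞 ×
      (∀ {i} → i ∈ₗ Σ′ → premise i ⊆ ∁ U₂ ⊎ premise i ⊆ U₂) ×
      (∀ {i} → i ∈ₗ Σ′ → ¬ InsideOf (∁ U₂) i → ¬ InsideOf U₂ i → premise i ⊆ ∁ U₂)

  Restrict : Family n → Subset n → Family n
  Restrict 𝒞 U₂ C = 𝒞 C × C ⊆ U₂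

-- Let C ∈ 𝒞 have trace C₂ = C ∩ U₂. For any D ∈ 𝒞₂ with C₂ ⊆ D, replacing the trace by D gives
-- (C ∖ U₂) ∪ D, which is again in 𝒞: an implication of the base has its premise in U₁ or in U₂,
-- premises in U₂ are handled by D, and premises in U₁ by C, whose conclusions in U₂ already lie
-- in C₂ ⊆ D. A splitting C₂ = D ∩ D′ in 𝒞₂ thus lifts to C = ((C ∖ U₂) ∪ D) ∩ ((C ∖ U₂) ∪ D′) in 𝒞,
-- so meet-irreducibility of C in 𝒞 descends to C₂ in 𝒞₂.
module Submission where

open import Defs
open import Data.Nat using (ℕ)
open import Data.Fin.Subset using (Subset; ⊤; _∩_; _∪_; ∁; _∈_; _⊆_)
open import Data.Fin.Subset.Properties
  using (_∈?_; ⊆-reflexive; ⊆-antisym; x∈p∩q⁺; x∈p∩q⁻; x∈p∪q⁺; x∈p∪q⁻; x∈∁p⇒x∉p; x∉p⇒x∈∁p;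
         p∩q⊆p; p∩q⊆q; ∩-distribˡ-∪; ∪-distribˡ-∩; ∪-inverseˡ; ∩-identityʳ)
open import Data.List using (List)
open import Data.List.Membership.Propositional using () renaming (_∈_ to _∈ₗ_)
open import Data.Product using (_,_; proj₁; proj₂)
open import Data.Sum using (_⊎_; inj₁; inj₂)
open import Data.Empty using (⊥-elim)
open import Relation.Binary.PropositionalEquality using (_≡_; _≢_; refl; sym; trans; cong; module ≡-Reasoning)
open import Function using (_∘_)
open import Relation.Nullary using (¬_; yes; no)
open import Relation.Unary using (Decidable)

module _ {n : ℕ} where

  base-sound : ∀ {Σ′ : List (Implication {n})} {𝒞 : Family n} {C i} →
               IsImplicationalBase Σ′ 𝒞 → 𝒞 C → i ∈ₗ Σ′ → Respects C i
  base-sound {C = C} base 𝒞C = proj₁ (proj₂ base C) 𝒞C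

  base-complete : ∀ {Σ′ : List (Implication {n})} {𝒞 : Family n} → IsImplicationalBase Σ′ 𝒞 →
                  ∀ C → (∀ {i} → i ∈ₗ Σ′ → Respects C i) → 𝒞 C
  base-complete base C = proj₂ (proj₂ base C)

  PremisesSplitBy : Subset n → List Implication → Set
  PremisesSplitBy U₂ Σ′ = ∀ {i} → i ∈ₗ Σ′ → premise i ⊆ ∁ U₂ ⊎ premise i ⊆ U₂

module WithTrace {n : ℕ} (U₂ C : Subset n) where

  withTrace : Subset n → Subset n
  withTrace D = (C ∩ ∁ U₂) ∪ D

  module _ {D : Subset n} (D⊆U₂ : D ⊆ U₂) where

    withTrace-inside : ∀ {x} → x ∈ withTrace D → x ∈ U₂ → x ∈ D
    withTrace-inside x∈ x∈U₂ with x∈p∪q⁻ (C ∩ ∁ U₂) D x∈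
    ... | inj₁ x∈C∖U₂ = ⊥-elim (x∈∁p⇒x∉p (proj₂ (x∈p∩q⁻ C (∁ U₂) x∈C∖U₂)) x∈U₂)
    ... | inj₂ x∈D    = x∈D

    withTrace-outside : ∀ {x} → x ∈ withTrace D → x ∈ ∁ U₂ → x ∈ C
    withTrace-outside x∈ x∉U₂ with x∈p∪q⁻ (C ∩ ∁ U₂) D x∈
    ... | inj₁ x∈C∖U₂ = proj₁ (x∈p∩q⁻ C (∁ U₂) x∈C∖U₂)
    ... | inj₂ x∈D    = ⊥-elim (x∈∁p⇒x∉p x∉U₂ (D⊆U₂ x∈D))

    withTrace-∩-U₂ : withTrace D ∩ U₂ ≡ D
    withTrace-∩-U₂ = ⊆-antisym
      (λ x∈ → let x∈T , x∈U₂ = x∈p∩q⁻ (withTrace D) U₂ x∈ in withTrace-inside x∈T x∈U₂)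
      (λ x∈D → x∈p∩q⁺ (x∈p∪q⁺ (inj₂ x∈D) , D⊆U₂ x∈D))

  withTrace-∩ : ∀ D D′ → C ∩ U₂ ≡ D ∩ D′ → withTrace D ∩ withTrace D′ ≡ C
  withTrace-∩ D D′ C∩U₂≡D∩D′ = begin
    ((C ∩ ∁ U₂) ∪ D) ∩ ((C ∩ ∁ U₂) ∪ D′) ≡⟨ sym (∪-distribˡ-∩ (C ∩ ∁ U₂) D D′) ⟩
    (C ∩ ∁ U₂) ∪ (D ∩ D′)                ≡⟨ cong ((C ∩ ∁ U₂) ∪_) (sym C∩U₂≡D∩D′) ⟩
    (C ∩ ∁ U₂) ∪ (C ∩ U₂)                ≡⟨ sym (∩-distribˡ-∪ C (∁ U₂) U₂) ⟩
    C ∩ (∁ U₂ ∪ U₂)                      ≡⟨ cong (C ∩_) (∪-inverseˡ U₂) ⟩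
    C ∩ ⊤                                ≡⟨ ∩-identityʳ C ⟩
    C                                    ∎
    where open ≡-Reasoning

  ⊆-withTrace : ∀ {D} → C ∩ U₂ ⊆ D → C ⊆ withTrace D
  ⊆-withTrace {D} C∩U₂⊆D {x} x∈C with x ∈? U₂
  ... | yes x∈U₂ = x∈p∪q⁺ (inj₂ (C∩U₂⊆D (x∈p∩q⁺ (x∈C , x∈U₂))))
  ... | no  x∉U₂ = x∈p∪q⁺ (inj₁ (x∈p∩q⁺ (x∈C , x∉p⇒x∈∁p x∉U₂)))

  withTrace-closed : ∀ {𝒞 : Family n} {Σ′} → IsImplicationalBase Σ′ 𝒞 → PremisesSplitBy U₂ Σ′ →
                     𝒞 C → ∀ {D} → Restrict 𝒞 U₂ D → C ∩ U₂ ⊆ D → 𝒞 (withTrace D)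
  withTrace-closed {Σ′ = Σ′} base split 𝒞C {D} (𝒞D , D⊆U₂) C∩U₂⊆D =
    base-complete base (withTrace D) respects
    where
    respects : ∀ {i} → i ∈ₗ Σ′ → Respects (withTrace D) i
    respects i∈Σ′ A⊆T with split i∈Σ′
    ... | inj₂ A⊆U₂ = x∈p∪q⁺ (inj₂ (base-sound base 𝒞D i∈Σ′
                        (λ a∈A → withTrace-inside D⊆U₂ (A⊆T a∈A) (A⊆U₂ a∈A))))
    ... | inj₁ A⊆U₁ = ⊆-withTrace C∩U₂⊆D (base-sound base 𝒞C i∈Σ′
                        (λ a∈A → withTrace-outside D⊆U₂ (A⊆T a∈A) (A⊆U₁ a∈A)))

open WithTrace

trace-irreducible : ∀ {n} {𝒞 : Family n} {Σ′ U₂ C} →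
  IsImplicationalBase Σ′ 𝒞 → PremisesSplitBy U₂ Σ′ → 𝒞 C →
  (∀ B B′ → 𝒞 B → 𝒞 B′ → C ≡ B ∩ B′ → C ≡ B ⊎ C ≡ B′) →
  ∀ D D′ → Restrict 𝒞 U₂ D → Restrict 𝒞 U₂ D′ → C ∩ U₂ ≡ D ∩ D′ →
  C ∩ U₂ ≡ D ⊎ C ∩ U₂ ≡ D′
trace-irreducible {U₂ = U₂} {C} base split 𝒞C C-irreducible D D′ 𝒞₂D 𝒞₂D′ C∩U₂≡D∩D′
  with C-irreducible (withTrace U₂ C D) (withTrace U₂ C D′)
         (withTrace-closed U₂ C base split 𝒞C 𝒞₂D (p∩q⊆p D D′ ∘ ⊆-reflexive C∩U₂≡D∩D′))
         (withTrace-closed U₂ C base split 𝒞C 𝒞₂D′ (p∩q⊆q D D′ ∘ ⊆-reflexive C∩U₂≡D∩D′))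
         (sym (withTrace-∩ U₂ C D D′ C∩U₂≡D∩D′))
... | inj₁ C≡T = inj₁ (trans (cong (_∩ U₂) C≡T) (withTrace-∩-U₂ U₂ C (proj₂ 𝒞₂D)))
... | inj₂ C≡T = inj₂ (trans (cong (_∩ U₂) C≡T) (withTrace-∩-U₂ U₂ C (proj₂ 𝒞₂D′)))

lemma3 : {n : ℕ} (𝒞 : Family n) → Decidable 𝒞 →
    IsClosureSystem 𝒞 → IsStandard 𝒞 →
    (U₂ : Subset n) → IsAcyclicSplit 𝒞 U₂ →
    (C₂ : Subset n) → Restrict 𝒞 U₂ C₂ → C₂ ≢ U₂ →
    ¬ IsMeetIrreducible (Restrict 𝒞 U₂) U₂ C₂ →
    (C : Subset n) → 𝒞 C → C ∩ U₂ ≡ C₂ → ¬ IsMeetIrreducible 𝒞 ⊤ C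
lemma3 𝒞 _ _ _ U₂ (_ , _ , _ , Σ′ , base , split , _) C₂ 𝒞₂C₂ C₂≢U₂ C₂-reducible C 𝒞C refl
       (_ , _ , C-irreducible) =
  C₂-reducible (𝒞₂C₂ , C₂≢U₂ , trace-irreducible base split 𝒞C C-irreducible)
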